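{- For all positive integers $r,k,n,m$ with $r\geq k$, $$\mathrm{tc}_{r,k}(K_{n,m}) \leq \begin{cases} r-k+1, & \text{if } k\geq r/2,\\ 2r-3k+1, & \text{if } r/2>k\geq 2r/5,\\ 2r-3k+2, & \text{otherwise.}\end{cases}$$
   Context: For integers $r\geq k\geq 1$, an $(r,k)$-colouring of a graph $G$ is a function $\varphi:E(G)\to\binom{[r]}{k}$, assigning to each edge a set of exactly $k$ colours from $[r]=\{1,\dots,r\}$. A subgraph $H\subseteq G$ is monochromatic if there is a colour $i$ belonging to $\varphi(e)$ for every $e\in E(H)$. For an $(r,k)$-colouring $\varphi$ of $G$, $\mathrm{tc}(G,\varphi)$ is the minimum number of monochromatic trees (not necessarily of the same colour; a single vertex counts as a tree) whose union covers $V(G)$. The tree cover number $\mathrm{tc}_{r,k}(G)$ is the minimum $m$ such that every $(r,k)$-colouring $\varphi$ of $E(G)$ satisfies $\mathrm{tc}(G,\varphi)\leq m$. $K_{n,m}$ is the complete bipartite graph with parts of sizes $n$ and $m$. -}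

module Defs where

open import Data.Nat using (ℕ; zero; suc; _+_; _*_; _∸_; _≤_; _≤?_)
open import Data.Fin using (Fin)
open import Data.Fin.Subset using (Subset; ∣_∣) renaming (_∈_ to _∈ₛ_)
open import Data.Sum using (_⊎_; inj₁; inj₂)
open import Data.Product using (Σ; _×_; _,_; ∃)
open import Data.List using (List; []; _∷_; length)
open import Data.List.Membership.Propositional using (_∈_; _∉_)
open import Data.List.Relation.Unary.Any using (Any)
open import Data.Empty using (⊥)
open import Relation.Binary.PropositionalEquality using (_≡_)
open import Relation.Nullary using (yes; no)

Vertex : ℕ → ℕ → Set
Vertex n m = Fin n ⊎ Fin m

record Colouring (r k n m : ℕ) : Set where
  field
    col  : Fin n → Fin m → Subset r
    size : ∀ i j → ∣ col i j ∣ ≡ k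
open Colouring public

EdgeHasColour : ∀ {r k n m} → Colouring r k n m → Fin r → Vertex n m → Vertex n m → Set
EdgeHasColour φ c (inj₁ i) (inj₂ j) = c ∈ₛ col φ i j
EdgeHasColour φ c (inj₂ j) (inj₁ i) = c ∈ₛ col φ i j
EdgeHasColour φ c (inj₁ _) (inj₁ _) = ⊥
EdgeHasColour φ c (inj₂ _) (inj₂ _) = ⊥

-- Finite trees are built from a single vertex
-- by repeatedly attaching a new leaf to an existing vertex.
data MonoTree {r k n m : ℕ} (φ : Colouring r k n m) (c : Fin r) : List (Vertex n m) → Set where
  single : (v : Vertex n m) → MonoTree φ c (v ∷ [])
  grow   : ∀ {vs} {u v} → MonoTree φ c vs → u ∈ vs → v ∉ vs →
           EdgeHasColour φ c u v → MonoTree φ c (v ∷ vs)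

record MonoTreeOf {r k n m : ℕ} (φ : Colouring r k n m) : Set where
  constructor mkTree
  field
    colour   : Fin r
    vertices : List (Vertex n m)
    isTree   : MonoTree φ colour vertices
open MonoTreeOf public

TcAtMost : ∀ {r k n m} → Colouring r k n m → ℕ → Set
TcAtMost {n = n} {m = m} φ t =
  Σ (List (MonoTreeOf φ)) λ ts →
    (length ts ≤ t) × (∀ (v : Vertex n m) → Any (λ T → v ∈ vertices T) ts)

TcRKAtMost : ℕ → ℕ → ℕ → ℕ → ℕ → Set
TcRKAtMost r k n m t = (φ : Colouring r k n m) → TcAtMost φ t

bound : ℕ → ℕ → ℕ
bound r k with r ≤? 2 * k
... | yes _ = r ∸ k + 1
... | no _ with 2 * r ≤? 5 * k
...   | yes _ = 2 * r ∸ 3 * k + 1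
...   | no _  = 2 * r ∸ 3 * k + 2

-- Every tree used is a monochromatic ball of radius 4, so a cover amounts to colour sets
-- attached to one or two roots. Fix an edge ab with colour set C and write r = 2k + h. A
-- k-set of colours meets every set of r - k + 1 colours; hence if r < 2k, any r - k + 1
-- colours of C at a reach every vertex directly or through b, and in general C together
-- with h + 1 further colours at a, plus those h + 1 colours at b, cover everything. One
-- tree is saved when h < k. If some colour d outside C forms a path a-x-y-b, then d can
-- replace one of the colours at b. Otherwise take k-sets E, E' whose union is the
-- complement of C. Using at a the complement of E plus one colour of E, and at b the rest
-- of the complement of C, fails only at a vertex y that has no monochromatic 2-path to a
-- and sees all of E on its edge to b; symmetrically, with the parts exchanged, for E' at
-- some x. Then the edge yx carries exactly the colours C, and C at a together with h + 1
-- colours of C at y suffice.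

module Submission where

open import Defs
open import Data.Nat using (ℕ; _≤_)

open import Data.Nat using (zero; suc; _+_; _*_; _∸_; _<_; _≰_; z≤n; s≤s; _≤?_)
open import Data.Nat.Properties
open import Data.Nat.Tactic.RingSolver using (solve-∀)
open import Data.Fin using (Fin; zero; suc) renaming (_≟_ to _≟ᶠ_)
open import Data.Fin.Properties using (any?; all?; ¬∀⟶∃¬)
open import Data.Fin.Subset
  using (Subset; inside; outside; ∣_∣; ⊥; ∁; _∩_; _∪_; _─_; _-_; ⁅_⁆; _⊆_; Nonempty; Empty)
  renaming (_∈_ to _∈ₛ_; _∉_ to _∉ₛ_)
open import Data.Fin.Subset.Properties
  using ( drop-∷-⊆; s⊆s; out⊆; ⊥⊆; ∣⊥∣≡0; ∣p∣≤n; Empty-unique; nonempty?; p⊂q⇒∣p∣<∣q∣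
        ; ∣∁p∣≡n∸∣p∣; x∈p∩q⁻; x∈p∪q⁺; x∈p∪q⁻; x∈∁p⇒x∉p; x∉p⇒x∈∁p; x∉∁p⇒x∈p
        ; x∈⁅y⁆⇒x≡y; ∣⁅x⁆∣≡1; x∈p∧x∉q⇒x∈p─q; p─q⊆p; x∈p∧x≢y⇒x∈p-y)
  renaming (_∈?_ to _∈ₛ?_)
open import Data.Vec using ([]; _∷_)
import Data.Vec.Base as Vec
open import Data.Sum using (_⊎_; inj₁; inj₂)
open import Data.Sum.Properties using (≡-dec)
open import Data.Product using (Σ; _×_; _,_; ∃; ∃₂; proj₁; proj₂)
open import Data.List using (List; []; _∷_; map; length; _++_; allFin)
open import Data.List.Properties using (length-map; length-++)
open import Data.List.Membership.Propositional using (_∈_; _∉_; find; lose)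
open import Data.List.Membership.Propositional.Properties
  using (∈-map⁺; ∈-map⁻; ∈-allFin; ∈-++⁺ˡ; ∈-++⁺ʳ)
open import Data.List.Relation.Unary.Any using (Any; here; there)
import Data.List.Relation.Unary.Any as Any
open import Data.List.Relation.Unary.Any.Properties using (map⁺; ++⁺ˡ; ++⁺ʳ)
import Data.List.Membership.DecPropositional as DecMembership
open import Relation.Binary.PropositionalEquality
open import Relation.Nullary using (¬_; Dec; yes; no; contradiction)
open import Relation.Nullary.Decidable using (_×-dec_; _⊎-dec_; ¬?)
open import Function using (id; _∘_)

-- Cardinalities of subsets of Fin n

∣p∪q∣+∣p∩q∣≡∣p∣+∣q∣ : ∀ {n} (p q : Subset n) → ∣ p ∪ q ∣ + ∣ p ∩ q ∣ ≡ ∣ p ∣ + ∣ q ∣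
∣p∪q∣+∣p∩q∣≡∣p∣+∣q∣ [] [] = refl
∣p∪q∣+∣p∩q∣≡∣p∣+∣q∣ (inside ∷ p) (inside ∷ q) =
  cong suc (trans (+-suc _ _) (trans (cong suc (∣p∪q∣+∣p∩q∣≡∣p∣+∣q∣ p q)) (sym (+-suc _ _))))
∣p∪q∣+∣p∩q∣≡∣p∣+∣q∣ (inside ∷ p) (outside ∷ q) = cong suc (∣p∪q∣+∣p∩q∣≡∣p∣+∣q∣ p q)
∣p∪q∣+∣p∩q∣≡∣p∣+∣q∣ (outside ∷ p) (inside ∷ q) =
  trans (cong suc (∣p∪q∣+∣p∩q∣≡∣p∣+∣q∣ p q)) (sym (+-suc _ _))
∣p∪q∣+∣p∩q∣≡∣p∣+∣q∣ (outside ∷ p) (outside ∷ q) = ∣p∪q∣+∣p∩q∣≡∣p∣+∣q∣ p q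

Empty⇒∣p∣≡0 : ∀ {n} {p : Subset n} → Empty p → ∣ p ∣ ≡ 0
Empty⇒∣p∣≡0 {n} p-empty = trans (cong ∣_∣ (Empty-unique p-empty)) (∣⊥∣≡0 n)

0<∣p∣⇒Nonempty : ∀ {n} {p : Subset n} → 0 < ∣ p ∣ → Nonempty p
0<∣p∣⇒Nonempty {p = p} 0<∣p∣ with nonempty? p
... | yes p-nonempty = p-nonempty
... | no p-empty = contradiction (sym (Empty⇒∣p∣≡0 p-empty)) (<⇒≢ 0<∣p∣)

∣p∪q∣≡∣p∣+∣q∣ : ∀ {n} {p q : Subset n} → (∀ {x} → x ∈ₛ p → x ∉ₛ q) → ∣ p ∪ q ∣ ≡ ∣ p ∣ + ∣ q ∣
∣p∪q∣≡∣p∣+∣q∣ {p = p} {q} disjoint = begin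
  ∣ p ∪ q ∣                ≡⟨ +-identityʳ _ ⟨
  ∣ p ∪ q ∣ + 0            ≡⟨ cong (∣ p ∪ q ∣ +_) (Empty⇒∣p∣≡0 p∩q-empty) ⟨
  ∣ p ∪ q ∣ + ∣ p ∩ q ∣    ≡⟨ ∣p∪q∣+∣p∩q∣≡∣p∣+∣q∣ p q ⟩
  ∣ p ∣ + ∣ q ∣            ∎
  where
  open ≡-Reasoning
  p∩q-empty : Empty (p ∩ q)
  p∩q-empty (x , x∈p∩q) = let x∈p , x∈q = x∈p∩q⁻ p q x∈p∩q in disjoint x∈p x∈q

pigeonhole-∩ : ∀ {n} {p q : Subset n} → n < ∣ p ∣ + ∣ q ∣ → ∃ λ x → x ∈ₛ p × x ∈ₛ q
pigeonhole-∩ {n} {p} {q} n<∣p∣+∣q∣ =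
  let x , x∈p∩q = 0<∣p∣⇒Nonempty (+-cancelˡ-< n 0 _ n+0<n+∣p∩q∣) in x , x∈p∩q⁻ p q x∈p∩q
  where
  open ≤-Reasoning
  n+0<n+∣p∩q∣ : n + 0 < n + ∣ p ∩ q ∣
  n+0<n+∣p∩q∣ = begin-strict
    n + 0                    ≡⟨ +-identityʳ n ⟩
    n                        <⟨ n<∣p∣+∣q∣ ⟩
    ∣ p ∣ + ∣ q ∣            ≡⟨ ∣p∪q∣+∣p∩q∣≡∣p∣+∣q∣ p q ⟨
    ∣ p ∪ q ∣ + ∣ p ∩ q ∣    ≤⟨ +-monoˡ-≤ _ (∣p∣≤n (p ∪ q)) ⟩
    n + ∣ p ∩ q ∣            ∎

x∈p⇒⁅x⁆⊆p : ∀ {n} {x : Fin n} {p : Subset n} → x ∈ₛ p → ⁅ x ⁆ ⊆ p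
x∈p⇒⁅x⁆⊆p {x = x} {p} x∈p y∈⁅x⁆ = subst (_∈ₛ p) (sym (x∈⁅y⁆⇒x≡y x y∈⁅x⁆)) x∈p

∣p∣+j≡n⇒∣∁p∣≡j : ∀ {n j} (p : Subset n) → ∣ p ∣ + j ≡ n → ∣ ∁ p ∣ ≡ j
∣p∣+j≡n⇒∣∁p∣≡j {n} {j} p ∣p∣+j≡n = begin
  ∣ ∁ p ∣                  ≡⟨ ∣∁p∣≡n∸∣p∣ p ⟩
  n ∸ ∣ p ∣                ≡⟨ cong (_∸ ∣ p ∣) ∣p∣+j≡n ⟨
  ∣ p ∣ + j ∸ ∣ p ∣        ≡⟨ m+n∸m≡n ∣ p ∣ j ⟩
  j                        ∎
  where open ≡-Reasoning

∣q∣+∣p─q∣≡∣p∣ : ∀ {n} {p q : Subset n} → q ⊆ p → ∣ q ∣ + ∣ p ─ q ∣ ≡ ∣ p ∣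
∣q∣+∣p─q∣≡∣p∣ {p = []} {[]} _ = refl
∣q∣+∣p─q∣≡∣p∣ {p = inside ∷ p} {inside ∷ q} q⊆p = cong suc (∣q∣+∣p─q∣≡∣p∣ (drop-∷-⊆ q⊆p))
∣q∣+∣p─q∣≡∣p∣ {p = inside ∷ p} {outside ∷ q} q⊆p =
  trans (+-suc _ _) (cong suc (∣q∣+∣p─q∣≡∣p∣ (drop-∷-⊆ q⊆p)))
∣q∣+∣p─q∣≡∣p∣ {p = outside ∷ p} {inside ∷ q} q⊆p = contradiction (q⊆p Vec.here) λ ()
∣q∣+∣p─q∣≡∣p∣ {p = outside ∷ p} {outside ∷ q} q⊆p = ∣q∣+∣p─q∣≡∣p∣ (drop-∷-⊆ q⊆p)

p⊆q∧∣q∣≤∣p∣⇒q⊆p : ∀ {n} {p q : Subset n} → p ⊆ q → ∣ q ∣ ≤ ∣ p ∣ → q ⊆ p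
p⊆q∧∣q∣≤∣p∣⇒q⊆p {p = p} p⊆q ∣q∣≤∣p∣ {x} x∈q with x ∈ₛ? p
... | yes x∈p = x∈p
... | no x∉p = contradiction ∣q∣≤∣p∣ (<⇒≱ (p⊂q⇒∣p∣<∣q∣ (p⊆q , x , x∈q , x∉p)))

⊆-interpolate : ∀ {n t} {q p : Subset n} → q ⊆ p → ∣ q ∣ ≤ t → t ≤ ∣ p ∣ →
                ∃ λ s → q ⊆ s × s ⊆ p × ∣ s ∣ ≡ t
⊆-interpolate {q = []} {[]} _ z≤n z≤n = [] , id , id , refl
⊆-interpolate {q = inside ∷ q} {outside ∷ p} q⊆p _ _ = contradiction (q⊆p Vec.here) λ ()
⊆-interpolate {q = outside ∷ q} {outside ∷ p} q⊆p ∣q∣≤t t≤∣p∣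
  with ⊆-interpolate (drop-∷-⊆ q⊆p) ∣q∣≤t t≤∣p∣
... | s , q⊆s , s⊆p , ∣s∣≡t = outside ∷ s , s⊆s q⊆s , s⊆s s⊆p , ∣s∣≡t
⊆-interpolate {q = inside ∷ q} {inside ∷ p} q⊆p (s≤s ∣q∣≤t) (s≤s t≤∣p∣)
  with ⊆-interpolate (drop-∷-⊆ q⊆p) ∣q∣≤t t≤∣p∣
... | s , q⊆s , s⊆p , ∣s∣≡t = inside ∷ s , s⊆s q⊆s , s⊆s s⊆p , cong suc ∣s∣≡t
⊆-interpolate {q = outside ∷ q} {inside ∷ p} q⊆p ∣q∣≤t t≤∣p∣ with m≤n⇒m<n∨m≡n ∣q∣≤t
... | inj₂ ∣q∣≡t = outside ∷ q , id , q⊆p , ∣q∣≡t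
... | inj₁ (s≤s ∣q∣≤t′) with ⊆-interpolate (drop-∷-⊆ q⊆p) ∣q∣≤t′ (≤-pred t≤∣p∣)
...   | s , q⊆s , s⊆p , ∣s∣≡t′ = inside ∷ s , out⊆ q⊆s , s⊆s s⊆p , cong suc ∣s∣≡t′

⊆-ofSize : ∀ {n t} {p : Subset n} → t ≤ ∣ p ∣ → ∃ λ s → s ⊆ p × ∣ s ∣ ≡ t
⊆-ofSize {n} t≤∣p∣ =
  let s , _ , s⊆p , ∣s∣≡t = ⊆-interpolate ⊥⊆ (subst (_≤ _) (sym (∣⊥∣≡0 n)) z≤n) t≤∣p∣ in s , s⊆p , ∣s∣≡t

elements : ∀ {n} → Subset n → List (Fin n)
elements [] = []
elements (inside ∷ p) = zero ∷ map suc (elements p)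
elements (outside ∷ p) = map suc (elements p)

length-elements : ∀ {n} (p : Subset n) → length (elements p) ≡ ∣ p ∣
length-elements [] = refl
length-elements (inside ∷ p) = cong suc (trans (length-map suc (elements p)) (length-elements p))
length-elements (outside ∷ p) = trans (length-map suc (elements p)) (length-elements p)

∈-elements : ∀ {n} {x : Fin n} (p : Subset n) → x ∈ₛ p → x ∈ elements p
∈-elements (inside ∷ p) Vec.here = here refl
∈-elements (inside ∷ p) (Vec.there x∈p) = there (∈-map⁺ suc (∈-elements p x∈p))
∈-elements (outside ∷ p) (Vec.there x∈p) = ∈-map⁺ suc (∈-elements p x∈p)

-- Monochromatic balls in K_{n,m}

allVertices : ∀ n m → List (Vertex n m)
allVertices n m = map inj₁ (allFin n) ++ map inj₂ (allFin m)

∈-allVertices : ∀ {n m} (v : Vertex n m) → v ∈ allVertices n m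
∈-allVertices (inj₁ i) = ∈-++⁺ˡ (∈-map⁺ inj₁ (∈-allFin i))
∈-allVertices {n} (inj₂ j) = ∈-++⁺ʳ (map inj₁ (allFin n)) (∈-map⁺ inj₂ (∈-allFin j))

module _ {r k n m : ℕ} (φ : Colouring r k n m) where

  open DecMembership (≡-dec (_≟ᶠ_ {n}) (_≟ᶠ_ {m})) using () renaming (_∈?_ to _∈ᵛ?_)

  edge? : ∀ c (u v : Vertex n m) → Dec (EdgeHasColour φ c u v)
  edge? c (inj₁ i) (inj₂ j) = c ∈ₛ? col φ i j
  edge? c (inj₂ j) (inj₁ i) = c ∈ₛ? col φ i j
  edge? c (inj₁ _) (inj₁ _) = no λ ()
  edge? c (inj₂ _) (inj₂ _) = no λ ()

  data Reach (c : Fin r) : ℕ → Vertex n m → Vertex n m → Set where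
    stay : ∀ {ℓ v} → Reach c ℓ v v
    step : ∀ {ℓ u v w} → Reach c ℓ u v → EdgeHasColour φ c v w → Reach c (suc ℓ) u w

  record Extension (c : Fin r) (vs ws : List (Vertex n m)) : Set where
    field
      grown   : List (Vertex n m)
      tree    : MonoTree φ c grown
      keeps   : ∀ {z} → z ∈ vs → z ∈ grown
      absorbs : ∀ {u w} → w ∈ ws → u ∈ vs → EdgeHasColour φ c u w → w ∈ grown
  open Extension

  private
    absorbing : ∀ {c vs w ws} (E : Extension c vs ws) →
                (∀ {u} → u ∈ vs → EdgeHasColour φ c u w → w ∈ grown E) → Extension c vs (w ∷ ws)
    absorbing E absorbs-w = record
      { grown   = grown E
      ; tree    = tree E
      ; keeps   = keeps E
      ; absorbs = λ { (here refl) → absorbs-w ; (there w∈ws) → absorbs E w∈ws } }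

    grafting : ∀ {c vs w ws} (E : Extension c (w ∷ vs) ws) → Extension c vs (w ∷ ws)
    grafting E = record
      { grown   = grown E
      ; tree    = tree E
      ; keeps   = keeps E ∘ there
      ; absorbs = λ { (here refl) _ _ → keeps E (here refl)
                    ; (there w∈ws) u∈vs e → absorbs E w∈ws (there u∈vs) e } }

  attach : ∀ c {vs} → MonoTree φ c vs → (ws : List (Vertex n m)) → Extension c vs ws
  attach c {vs} T [] = record { grown = vs ; tree = T ; keeps = id ; absorbs = λ () }
  attach c {vs} T (w ∷ ws) with w ∈ᵛ? vs | Any.any? (λ u → edge? c u w) vs
  ... | yes w∈vs | _ = let E = attach c T ws in absorbing E λ _ _ → keeps E w∈vs
  ... | no w∉vs | yes has-neighbour =
    let u , u∈vs , e = find has-neighbour in grafting (attach c (grow T u∈vs w∉vs e) ws)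
  ... | no _ | no no-neighbour =
    absorbing (attach c T ws) λ u∈vs e → contradiction (lose u∈vs e) no-neighbour

  ball : (c : Fin r) → Vertex n m → ℕ → Σ (List (Vertex n m)) (MonoTree φ c)
  ball c v zero = v ∷ [] , single v
  ball c v (suc ℓ) = let E = attach c (proj₂ (ball c v ℓ)) (allVertices n m) in grown E , tree E

  root∈ball : ∀ c v ℓ → v ∈ proj₁ (ball c v ℓ)
  root∈ball c v zero = here refl
  root∈ball c v (suc ℓ) = keeps (attach c (proj₂ (ball c v ℓ)) (allVertices n m)) (root∈ball c v ℓ)

  reach⇒∈ball : ∀ {c ℓ v z} → Reach c ℓ v z → z ∈ proj₁ (ball c v ℓ)
  reach⇒∈ball {c} {ℓ} {v} stay = root∈ball c v ℓ
  reach⇒∈ball {c} {suc ℓ} {v} (step {w = w} reach e) =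
    absorbs (attach c (proj₂ (ball c v ℓ)) (allVertices n m)) (∈-allVertices w) (reach⇒∈ball reach) e

  CoveredFrom : ℕ → Vertex n m → Subset r → Vertex n m → Set
  CoveredFrom ℓ root U v = ∃ λ c → c ∈ₛ U × Reach c ℓ root v

  balls-cover : ∀ ℓ (ra rb : Vertex n m) (U W : Subset r) →
                (∀ v → CoveredFrom ℓ ra U v ⊎ CoveredFrom ℓ rb W v) → TcAtMost φ (∣ U ∣ + ∣ W ∣)
  balls-cover ℓ ra rb U W covered = treesA ++ treesB , ≤-reflexive count , covers
    where
    ballAt : Vertex n m → Fin r → MonoTreeOf φ
    ballAt root c = mkTree c _ (proj₂ (ball c root ℓ))
    treesA = map (ballAt ra) (elements U)
    treesB = map (ballAt rb) (elements W)
    count : length (treesA ++ treesB) ≡ ∣ U ∣ + ∣ W ∣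
    count = trans (length-++ treesA) (cong₂ _+_
      (trans (length-map _ (elements U)) (length-elements U))
      (trans (length-map _ (elements W)) (length-elements W)))
    covers : ∀ v → Any (λ T → v ∈ vertices T) (treesA ++ treesB)
    covers v with covered v
    ... | inj₁ (c , c∈U , reach) = ++⁺ˡ (map⁺ (lose (∈-elements U c∈U) (reach⇒∈ball reach)))
    ... | inj₂ (c , c∈W , reach) = ++⁺ʳ treesA (map⁺ (lose (∈-elements W c∈W) (reach⇒∈ball reach)))

  TcAtMost-mono : ∀ {s t} → s ≤ t → TcAtMost φ s → TcAtMost φ t
  TcAtMost-mono s≤t (ts , ∣ts∣≤s , covers) = ts , ≤-trans ∣ts∣≤s s≤t , covers

transpose : ∀ {r k n m} → Colouring r k n m → Colouring r k m n
transpose φ = record { col = λ j i → col φ i j ; size = λ j i → size φ i j }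

swap : ∀ {n m} → Vertex n m → Vertex m n
swap (inj₁ i) = inj₂ i
swap (inj₂ j) = inj₁ j

swap-involutive : ∀ {n m} (v : Vertex n m) → swap (swap v) ≡ v
swap-involutive (inj₁ i) = refl
swap-involutive (inj₂ j) = refl

module _ {r k n m : ℕ} (φ : Colouring r k n m) where

  swap-edge : ∀ {c} (u v : Vertex m n) →
              EdgeHasColour (transpose φ) c u v → EdgeHasColour φ c (swap u) (swap v)
  swap-edge (inj₁ j) (inj₂ i) e = e
  swap-edge (inj₂ i) (inj₁ j) e = e

  swap-∉ : ∀ {v : Vertex m n} {vs} → v ∉ vs → swap v ∉ map swap vs
  swap-∉ {v} {vs} v∉vs swap-v∈ with ∈-map⁻ swap swap-v∈
  ... | u , u∈vs , swap-v≡swap-u = v∉vs (subst (_∈ vs) u≡v u∈vs)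
    where
    u≡v : u ≡ v
    u≡v = trans (sym (swap-involutive u)) (trans (sym (cong swap swap-v≡swap-u)) (swap-involutive v))

  swap-tree : ∀ {c vs} → MonoTree (transpose φ) c vs → MonoTree φ c (map swap vs)
  swap-tree (single v) = single (swap v)
  swap-tree (grow {u = u} {v = v} T u∈vs v∉vs e) =
    grow (swap-tree T) (∈-map⁺ swap u∈vs) (swap-∉ v∉vs) (swap-edge u v e)

  transpose-TcAtMost : ∀ {t} → TcAtMost (transpose φ) t → TcAtMost φ t
  transpose-TcAtMost (ts , ∣ts∣≤t , covers) =
    map swapped ts , subst (_≤ _) (sym (length-map swapped ts)) ∣ts∣≤t ,
    λ v → swap-covers ts (covers (swap v))
    where
    swapped : MonoTreeOf (transpose φ) → MonoTreeOf φ
    swapped (mkTree c vs T) = mkTree c (map swap vs) (swap-tree T)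
    swap-covers : ∀ {v : Vertex n m} ts → Any (λ T → swap v ∈ vertices T) ts →
                  Any (λ T → v ∈ vertices T) (map swapped ts)
    swap-covers {v} (mkTree c vs T ∷ _) (here swap-v∈) =
      here (subst (_∈ map swap vs) (swap-involutive v) (∈-map⁺ swap swap-v∈))
    swap-covers (_ ∷ ts) (there swap-v∈) = there (swap-covers ts swap-v∈)

-- Covers anchored at an edge ab

-- Radius 4 suffices: the longest walk used is a–x₀–y₀–b–y in linked-cover.
Near : ∀ {r k n m} → Colouring r k n m → Vertex n m → Subset r → Vertex n m → Set
Near φ = CoveredFrom φ 4

tc≤1+j : ∀ {r k n m j} (φ : Colouring r k n m) (a : Fin n) (b : Fin m) →
         r ≡ k + j → j < k → TcAtMost φ (suc j)
tc≤1+j {r} {k} {j = j} φ a b r≡k+j j<k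
  with ⊆-ofSize {p = col φ a b} (subst (suc j ≤_) (sym (size φ a b)) j<k)
... | C′ , C′⊆C , ∣C′∣≡1+j =
  subst (TcAtMost φ) (trans (cong₂ _+_ ∣C′∣≡1+j (∣⊥∣≡0 r)) (+-identityʳ _))
        (balls-cover φ 4 (inj₁ a) (inj₁ a) C′ ⊥ covered)
  where
  meets : ∀ i j′ → ∃ λ w → w ∈ₛ col φ i j′ × w ∈ₛ C′
  meets i j′ = pigeonhole-∩ (subst₂ (λ s c → r < s + c) (sym (size φ i j′)) (sym ∣C′∣≡1+j)
                                      (subst (_< k + suc j) (sym r≡k+j) (+-monoʳ-< k ≤-refl)))
  covered : ∀ v → Near φ (inj₁ a) C′ v ⊎ Near φ (inj₁ a) ⊥ v
  covered (inj₂ x) = let w , w∈ax , w∈C′ = meets a x in inj₁ (w , w∈C′ , step stay w∈ax)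
  covered (inj₁ y) = let w , w∈yb , w∈C′ = meets y b in
                     inj₁ (w , w∈C′ , step {v = inj₂ b} (step stay (C′⊆C w∈C′)) w∈yb)

module Corner {r k n m h : ℕ} (φ : Colouring r k n m) (a : Fin n) (b : Fin m)
              (1≤k : 1 ≤ k) (r≡2k+h : r ≡ k + k + h) where

  C : Subset r
  C = col φ a b

  ∣∁S∣≡k+h : ∀ (S : Subset r) → ∣ S ∣ ≡ k → ∣ ∁ S ∣ ≡ k + h
  ∣∁S∣≡k+h S ∣S∣≡k =
    ∣p∣+j≡n⇒∣∁p∣≡j S (trans (cong (_+ (k + h)) ∣S∣≡k) (sym (trans r≡2k+h (+-assoc k k h))))

  ∣∁C─E∣≡h : ∀ {E} → E ⊆ ∁ C → ∣ E ∣ ≡ k → ∣ ∁ C ─ E ∣ ≡ h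
  ∣∁C─E∣≡h {E} E⊆∁C ∣E∣≡k = +-cancelˡ-≡ k _ _
    (trans (cong (_+ ∣ ∁ C ─ E ∣) (sym ∣E∣≡k)) (trans (∣q∣+∣p─q∣≡∣p∣ E⊆∁C) (∣∁S∣≡k+h C (size φ a b))))

  k≤∣∁C∣ : k ≤ ∣ ∁ C ∣
  k≤∣∁C∣ = subst (k ≤_) (sym (∣∁S∣≡k+h C (size φ a b))) (m≤m+n k h)

  1+h≤∣∁C∣ : suc h ≤ ∣ ∁ C ∣
  1+h≤∣∁C∣ = subst (suc h ≤_) (sym (∣∁S∣≡k+h C (size φ a b))) (+-monoˡ-≤ h 1≤k)

  ∣C∪K∣ : ∀ {K} → K ⊆ ∁ C → ∣ K ∣ ≡ suc h → ∣ C ∪ K ∣ ≡ k + suc h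
  ∣C∪K∣ K⊆∁C ∣K∣≡1+h =
    trans (∣p∪q∣≡∣p∣+∣q∣ (λ x∈C x∈K → x∈∁p⇒x∉p (K⊆∁C x∈K) x∈C)) (cong₂ _+_ (size φ a b) ∣K∣≡1+h)

  meets : ∀ (S : Subset r) {U} → ∣ S ∣ ≡ k → ∣ U ∣ ≡ k + suc h → ∃ λ w → w ∈ₛ S × w ∈ₛ U
  meets S {U} ∣S∣≡k ∣U∣≡k+1+h = pigeonhole-∩ (begin-strict
    r               ≡⟨ trans r≡2k+h (+-assoc k k h) ⟩
    k + (k + h)     <⟨ +-monoʳ-< k (+-monoʳ-< k ≤-refl) ⟩
    k + (k + suc h) ≡⟨ cong₂ _+_ ∣S∣≡k ∣U∣≡k+1+h ⟨
    ∣ S ∣ + ∣ U ∣   ∎)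
    where open ≤-Reasoning

  near-a : ∀ {U} → ∣ U ∣ ≡ k + suc h → ∀ x → Near φ (inj₁ a) U (inj₂ x)
  near-a ∣U∣ x = let w , w∈ax , w∈U = meets (col φ a x) (size φ a x) ∣U∣ in w , w∈U , step stay w∈ax

  tc≤k+2h+2 : TcAtMost φ (k + suc h + suc h)
  tc≤k+2h+2 with ⊆-ofSize 1+h≤∣∁C∣
  ... | H , H⊆∁C , ∣H∣≡1+h =
    subst (TcAtMost φ) (cong₂ _+_ ∣U∣ ∣H∣≡1+h) (balls-cover φ 4 (inj₁ a) (inj₂ b) (C ∪ H) H covered)
    where
    ∣U∣ : ∣ C ∪ H ∣ ≡ k + suc h
    ∣U∣ = ∣C∪K∣ H⊆∁C ∣H∣≡1+h
    covered : ∀ v → Near φ (inj₁ a) (C ∪ H) v ⊎ Near φ (inj₂ b) H v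
    covered (inj₂ x) = inj₁ (near-a ∣U∣ x)
    covered (inj₁ y) with meets (col φ y b) (size φ y b) ∣U∣
    ... | w , w∈yb , w∈U with x∈p∪q⁻ C H w∈U
    ...   | inj₁ w∈C = inj₁ (w , w∈U , step {v = inj₂ b} (step stay w∈C) w∈yb)
    ...   | inj₂ w∈H = inj₂ (w , w∈H , step stay w∈yb)

  Linked : Fin r → Set
  Linked d = ∃₂ λ x y → d ∈ₛ col φ a x × d ∈ₛ col φ y x × d ∈ₛ col φ y b

  linked? : ∀ d → Dec (Linked d)
  linked? d = any? λ x → any? λ y → d ∈ₛ? col φ a x ×-dec d ∈ₛ? col φ y x ×-dec d ∈ₛ? col φ y b

  linked-cover : ∀ {d} → d ∉ₛ C → Linked d → TcAtMost φ (k + suc h + h)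
  linked-cover {d} d∉C (x₀ , y₀ , d∈ax₀ , d∈y₀x₀ , d∈y₀b)
    with ⊆-interpolate (x∈p⇒⁅x⁆⊆p (x∉p⇒x∈∁p d∉C)) (subst (_≤ suc h) (sym (∣⁅x⁆∣≡1 d)) (s≤s z≤n))
                       1+h≤∣∁C∣
  ... | K , ⁅d⁆⊆K , K⊆∁C , ∣K∣≡1+h =
    subst (TcAtMost φ) (cong₂ _+_ ∣U∣ ∣K-d∣)
          (balls-cover φ 4 (inj₁ a) (inj₂ b) (C ∪ K) (K - d) covered)
    where
    ∣U∣ : ∣ C ∪ K ∣ ≡ k + suc h
    ∣U∣ = ∣C∪K∣ K⊆∁C ∣K∣≡1+h
    ∣K-d∣ : ∣ K - d ∣ ≡ h
    ∣K-d∣ = suc-injective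
      (trans (cong (_+ ∣ K - d ∣) (sym (∣⁅x⁆∣≡1 d))) (trans (∣q∣+∣p─q∣≡∣p∣ ⁅d⁆⊆K) ∣K∣≡1+h))
    covered : ∀ v → Near φ (inj₁ a) (C ∪ K) v ⊎ Near φ (inj₂ b) (K - d) v
    covered (inj₂ x) = inj₁ (near-a ∣U∣ x)
    covered (inj₁ y) with meets (col φ y b) (size φ y b) ∣U∣
    ... | w , w∈yb , w∈U with x∈p∪q⁻ C K w∈U
    ...   | inj₁ w∈C = inj₁ (w , w∈U , step {v = inj₂ b} (step stay w∈C) w∈yb)
    ...   | inj₂ w∈K with w ≟ᶠ d
    ...     | yes refl = inj₁ (w , w∈U , a→x₀→y₀→b→y)
      where
      a→x₀→y₀→b→y : Reach φ d 4 (inj₁ a) (inj₁ y)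
      a→x₀→y₀→b→y =
        step {v = inj₂ b} (step {v = inj₁ y₀} (step {v = inj₂ x₀} (step stay d∈ax₀) d∈y₀x₀) d∈y₀b) w∈yb
    ...     | no w≢d = inj₂ (w , x∈p∧x≢y⇒x∈p-y w∈K w≢d , step stay w∈yb)

  NoLink : Set
  NoLink = ∀ d → d ∉ₛ C → ¬ Linked d

  Blocking : Subset r → Fin n → Set
  Blocking E y = (∀ x w → w ∈ₛ col φ a x → w ∉ₛ col φ y x) × E ⊆ col φ y b

  module _ (noLink : NoLink) {E : Subset r} (E⊆∁C : E ⊆ ∁ C) (∣E∣≡k : ∣ E ∣ ≡ k) where

    private
      E-nonempty : Nonempty E
      E-nonempty = 0<∣p∣⇒Nonempty (subst (0 <_) (sym ∣E∣≡k) 1≤k)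

      e : Fin r
      e = proj₁ E-nonempty

      U W : Subset r
      U = ∁ E ∪ ⁅ e ⁆
      W = ∁ C ─ E

      ∣U∣ : ∣ U ∣ ≡ k + suc h
      ∣U∣ = begin
        ∣ ∁ E ∪ ⁅ e ⁆ ∣     ≡⟨ ∣p∪q∣≡∣p∣+∣q∣ (λ x∈∁E x∈⁅e⁆ → x∈∁p⇒x∉p x∈∁E (⁅e⁆⊆E x∈⁅e⁆)) ⟩
        ∣ ∁ E ∣ + ∣ ⁅ e ⁆ ∣ ≡⟨ cong₂ _+_ (∣∁S∣≡k+h E ∣E∣≡k) (∣⁅x⁆∣≡1 e) ⟩
        k + h + 1           ≡⟨ +-assoc k h 1 ⟩
        k + (h + 1)         ≡⟨ cong (k +_) (+-comm h 1) ⟩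
        k + suc h           ∎
        where
        open ≡-Reasoning
        ⁅e⁆⊆E = x∈p⇒⁅x⁆⊆p (proj₂ E-nonempty)

      Reachable : Fin n → Set
      Reachable y = (∃ λ w → w ∈ₛ col φ y b × w ∉ₛ E)
                  ⊎ (∃₂ λ x w → w ∈ₛ col φ a x × w ∈ₛ col φ y x × w ∈ₛ U)

      reachable? : ∀ y → Dec (Reachable y)
      reachable? y = any? (λ w → w ∈ₛ? col φ y b ×-dec ¬? (w ∈ₛ? E))
               ⊎-dec any? (λ x → any? λ w → w ∈ₛ? col φ a x ×-dec w ∈ₛ? col φ y x ×-dec w ∈ₛ? U)

      reachable-cover : (∀ y → Reachable y) → TcAtMost φ (k + suc h + h)
      reachable-cover reachable =
        subst (TcAtMost φ) (cong₂ _+_ ∣U∣ (∣∁C─E∣≡h E⊆∁C ∣E∣≡k))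
              (balls-cover φ 4 (inj₁ a) (inj₂ b) U W covered)
        where
        covered : ∀ v → Near φ (inj₁ a) U v ⊎ Near φ (inj₂ b) W v
        covered (inj₂ x) = inj₁ (near-a ∣U∣ x)
        covered (inj₁ y) with reachable y
        ... | inj₂ (x , w , w∈ax , w∈yx , w∈U) = inj₁ (w , w∈U , step {v = inj₂ x} (step stay w∈ax) w∈yx)
        ... | inj₁ (w , w∈yb , w∉E) with w ∈ₛ? C
        ...   | yes w∈C =
          inj₁ (w , x∈p∪q⁺ (inj₁ (x∉p⇒x∈∁p w∉E)) , step {v = inj₂ b} (step stay w∈C) w∈yb)
        ...   | no w∉C = inj₂ (w , x∈p∧x∉q⇒x∈p─q (x∉p⇒x∈∁p w∉C) w∉E , step stay w∈yb)

      unreachable⇒blocking : ∀ {y} → ¬ Reachable y → Blocking E y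
      unreachable⇒blocking {y} unreachable = no-2-path , E⊆yb
        where
        yb⊆E : col φ y b ⊆ E
        yb⊆E {w} w∈yb with w ∈ₛ? E
        ... | yes w∈E = w∈E
        ... | no w∉E = contradiction (inj₁ (w , w∈yb , w∉E)) unreachable
        E⊆yb : E ⊆ col φ y b
        E⊆yb = p⊆q∧∣q∣≤∣p∣⇒q⊆p yb⊆E (≤-reflexive (trans ∣E∣≡k (sym (size φ y b))))
        no-2-path : ∀ x w → w ∈ₛ col φ a x → w ∉ₛ col φ y x
        no-2-path x w w∈ax w∈yx with w ∈ₛ? U
        ... | yes w∈U = unreachable (inj₂ (x , w , w∈ax , w∈yx , w∈U))
        ... | no w∉U = noLink w (x∈∁p⇒x∉p (E⊆∁C w∈E)) (x , y , w∈ax , w∈yx , E⊆yb w∈E)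
          where
          w∈E : w ∈ₛ E
          w∈E = x∉∁p⇒x∈p (w∉U ∘ x∈p∪q⁺ ∘ inj₁)

    cover-or-blocking : TcAtMost φ (k + suc h + h) ⊎ ∃ (Blocking E)
    cover-or-blocking with all? reachable?
    ... | yes reachable = inj₁ (reachable-cover reachable)
    ... | no ¬reachable =
      let y , unreachable = ¬∀⟶∃¬ n Reachable reachable? ¬reachable in
      inj₂ (y , unreachable⇒blocking unreachable)

  blocked-cover : ∀ {x y} → h < k →
                  (∀ x′ w → w ∈ₛ col φ a x′ → w ∉ₛ col φ y x′) →
                  (∀ y′ w → w ∈ₛ col φ y′ b → w ∉ₛ col φ y′ x) →
                  col φ y x ⊆ C → TcAtMost φ (k + suc h + h)
  blocked-cover {x} {y} h<k no-a-y no-b-x yx⊆C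
    with ⊆-ofSize {p = C} (subst (suc h ≤_) (sym (size φ a b)) h<k)
  ... | X , X⊆C , ∣X∣≡1+h =
    TcAtMost-mono φ (≤-trans (≤-reflexive (cong₂ _+_ (size φ a b) ∣X∣≡1+h)) (m≤m+n _ h))
                  (balls-cover φ 4 (inj₁ a) (inj₁ y) C X covered)
    where
    C⊆yx : C ⊆ col φ y x
    C⊆yx = p⊆q∧∣q∣≤∣p∣⇒q⊆p yx⊆C (≤-reflexive (trans (size φ a b) (sym (size φ y x))))
    meets-X∪ : ∀ S P → ∣ S ∣ ≡ k → ∣ P ∣ ≡ k → (∀ {w} → w ∈ₛ X → w ∉ₛ P) →
               ∃ λ w → w ∈ₛ S × w ∈ₛ X ∪ P
    meets-X∪ S P ∣S∣≡k ∣P∣≡k disjoint =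
      meets S ∣S∣≡k (trans (∣p∪q∣≡∣p∣+∣q∣ disjoint) (trans (cong₂ _+_ ∣X∣≡1+h ∣P∣≡k) (+-comm (suc h) k)))
    covered : ∀ v → Near φ (inj₁ a) C v ⊎ Near φ (inj₁ y) X v
    covered (inj₂ x′) with any? (λ w → w ∈ₛ? col φ a x′ ×-dec w ∈ₛ? C)
    ... | yes (w , w∈ax′ , w∈C) = inj₁ (w , w∈C , step stay w∈ax′)
    ... | no ax′∩C≡∅ with meets-X∪ (col φ y x′) (col φ a x′) (size φ y x′) (size φ a x′)
                                   (λ w∈X w∈ax′ → ax′∩C≡∅ (_ , w∈ax′ , X⊆C w∈X))
    ...   | w , w∈yx′ , w∈X∪ax′ with x∈p∪q⁻ X (col φ a x′) w∈X∪ax′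
    ...     | inj₁ w∈X = inj₂ (w , w∈X , step stay w∈yx′)
    ...     | inj₂ w∈ax′ = contradiction w∈yx′ (no-a-y x′ w w∈ax′)
    covered (inj₁ y′) with any? (λ w → w ∈ₛ? col φ y′ b ×-dec w ∈ₛ? C)
    ... | yes (w , w∈y′b , w∈C) = inj₁ (w , w∈C , step {v = inj₂ b} (step stay w∈C) w∈y′b)
    ... | no y′b∩C≡∅ with meets-X∪ (col φ y′ x) (col φ y′ b) (size φ y′ x) (size φ y′ b)
                                   (λ w∈X w∈y′b → y′b∩C≡∅ (_ , w∈y′b , X⊆C w∈X))
    ...   | w , w∈y′x , w∈X∪y′b with x∈p∪q⁻ X (col φ y′ b) w∈X∪y′b
    ...     | inj₁ w∈X = inj₂ (w , w∈X , step {v = inj₂ x} (step stay (C⊆yx (X⊆C w∈X))) w∈y′x)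
    ...     | inj₂ w∈y′b = contradiction w∈y′x (no-b-x y′ w w∈y′b)

module _ {r k n m h : ℕ} (φ : Colouring r k n m) (a : Fin n) (b : Fin m)
         (r≡2k+h : r ≡ k + k + h) (h<k : h < k) where

  private
    1≤k : 1 ≤ k
    1≤k = ≤-trans (s≤s z≤n) h<k

    open Corner φ a b 1≤k r≡2k+h
    module ψ = Corner (transpose φ) b a 1≤k r≡2k+h

  NoLink-transpose : NoLink → ψ.NoLink
  NoLink-transpose noLink d d∉C (x , y , d∈bx , d∈yx , d∈ya) = noLink d d∉C (y , x , d∈ya , d∈yx , d∈bx)

  unlinked-cover : NoLink → TcAtMost φ (k + suc h + h)
  unlinked-cover noLink with ⊆-ofSize {p = ∁ C} k≤∣∁C∣
  ... | E , E⊆∁C , ∣E∣≡k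
    with ⊆-interpolate (p─q⊆p (∁ C) E) (≤-trans (≤-reflexive (∣∁C─E∣≡h E⊆∁C ∣E∣≡k)) (<⇒≤ h<k)) k≤∣∁C∣
  ...   | E′ , ∁C─E⊆E′ , E′⊆∁C , ∣E′∣≡k with cover-or-blocking noLink E⊆∁C ∣E∣≡k
  ...     | inj₁ cover = cover
  ...     | inj₂ (y , no-a-y , E⊆yb) with ψ.cover-or-blocking (NoLink-transpose noLink) E′⊆∁C ∣E′∣≡k
  ...       | inj₁ coverᵀ = transpose-TcAtMost φ coverᵀ
  ...       | inj₂ (x , no-b-x , E′⊆ax) = blocked-cover h<k no-a-y no-b-x yx⊆C
    where
    yx⊆C : col φ y x ⊆ C
    yx⊆C {w} w∈yx with w ∈ₛ? C | w ∈ₛ? E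
    ... | yes w∈C | _ = w∈C
    ... | no _ | yes w∈E = contradiction w∈yx (no-b-x y w (E⊆yb w∈E))
    ... | no w∉C | no w∉E =
      contradiction w∈yx (no-a-y x w (E′⊆ax (∁C─E⊆E′ (x∈p∧x∉q⇒x∈p─q (x∉p⇒x∈∁p w∉C) w∉E))))

  tc≤k+2h+1 : TcAtMost φ (k + suc h + h)
  tc≤k+2h+1 with any? (λ d → ¬? (d ∈ₛ? C) ×-dec linked? d)
  ... | yes (d , d∉C , linked) = linked-cover d∉C linked
  ... | no noLink = unlinked-cover λ d d∉C linked → noLink (d , d∉C , linked)

-- Arithmetic of the bound

2[2k+h]≡3k+[k+h+h] : ∀ k h → 2 * (k + k + h) ≡ 3 * k + (k + h + h)
2[2k+h]≡3k+[k+h+h] = solve-∀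

2[2k+h]≡4k+[h+h] : ∀ k h → 2 * (k + k + h) ≡ 4 * k + (h + h)
2[2k+h]≡4k+[h+h] = solve-∀

5k≡4k+k : ∀ k → 5 * k ≡ 4 * k + k
5k≡4k+k = solve-∀

k+h+h+1≡k+[1+h]+h : ∀ k h → k + h + h + 1 ≡ k + suc h + h
k+h+h+1≡k+[1+h]+h = solve-∀

k+h+h+2≡k+[1+h]+[1+h] : ∀ k h → k + h + h + 2 ≡ k + suc h + suc h
k+h+h+2≡k+[1+h]+[1+h] = solve-∀

r≡2k+[r∸2k] : ∀ {r} k → 2 * k ≤ r → r ≡ k + k + (r ∸ 2 * k)
r≡2k+[r∸2k] {r} k 2k≤r =
  trans (sym (m+[n∸m]≡n 2k≤r)) (cong (λ 2k → 2k + (r ∸ 2 * k)) (cong (k +_) (+-identityʳ k)))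

2r∸3k≡k+h+h : ∀ {r} k h → r ≡ k + k + h → 2 * r ∸ 3 * k ≡ k + h + h
2r∸3k≡k+h+h k h refl =
  trans (cong (_∸ 3 * k) (2[2k+h]≡3k+[k+h+h] k h)) (m+n∸m≡n (3 * k) (k + h + h))

2r≤5k⇒h<k : ∀ {r} k h → 1 ≤ k → r ≡ k + k + h → 2 * r ≤ 5 * k → h < k
2r≤5k⇒h<k k zero 1≤k _ _ = 1≤k
2r≤5k⇒h<k k h@(suc _) _ refl 2r≤5k = <-≤-trans (m<m+n h (s≤s z≤n)) h+h≤k
  where
  h+h≤k : h + h ≤ k
  h+h≤k = +-cancelˡ-≤ (4 * k) (h + h) k (subst₂ _≤_ (2[2k+h]≡4k+[h+h] k h) (5k≡4k+k k) 2r≤5k)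

module _ {r k n m : ℕ} (φ : Colouring r k n m) (a : Fin n) (b : Fin m) (1≤k : 1 ≤ k) where

  tc≤r∸k+1 : k ≤ r → r ≤ 2 * k → TcAtMost φ (r ∸ k + 1)
  tc≤r∸k+1 k≤r r≤2k
    with m≤n⇒m<n∨m≡n (m≤n+o⇒m∸n≤o r k (subst (r ≤_) (cong (k +_) (+-identityʳ k)) r≤2k))
  ... | inj₁ r∸k<k = subst (TcAtMost φ) (+-comm 1 (r ∸ k)) (tc≤1+j φ a b (sym (m+[n∸m]≡n k≤r)) r∸k<k)
  ... | inj₂ r∸k≡k = subst (TcAtMost φ) (trans (+-identityʳ (k + 1)) (cong (_+ 1) (sym r∸k≡k)))
                           (tc≤k+2h+1 φ a b r≡2k+0 1≤k)
    where
    r≡2k+0 : r ≡ k + k + 0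
    r≡2k+0 = trans (sym (m+[n∸m]≡n k≤r)) (trans (cong (k +_) r∸k≡k) (sym (+-identityʳ (k + k))))

  tc≤2r∸3k+1 : r ≰ 2 * k → 2 * r ≤ 5 * k → TcAtMost φ (2 * r ∸ 3 * k + 1)
  tc≤2r∸3k+1 r≰2k 2r≤5k =
    subst (TcAtMost φ) count (tc≤k+2h+1 φ a b r≡2k+h (2r≤5k⇒h<k k h 1≤k r≡2k+h 2r≤5k))
    where
    h = r ∸ 2 * k
    r≡2k+h = r≡2k+[r∸2k] k (<⇒≤ (≰⇒> r≰2k))
    count : k + suc h + h ≡ 2 * r ∸ 3 * k + 1
    count = sym (trans (cong (_+ 1) (2r∸3k≡k+h+h k h r≡2k+h)) (k+h+h+1≡k+[1+h]+h k h))

  tc≤2r∸3k+2 : r ≰ 2 * k → TcAtMost φ (2 * r ∸ 3 * k + 2)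
  tc≤2r∸3k+2 r≰2k = subst (TcAtMost φ) count (Corner.tc≤k+2h+2 φ a b 1≤k r≡2k+h)
    where
    h = r ∸ 2 * k
    r≡2k+h = r≡2k+[r∸2k] k (<⇒≤ (≰⇒> r≰2k))
    count : k + suc h + suc h ≡ 2 * r ∸ 3 * k + 2
    count = sym (trans (cong (_+ 2) (2r∸3k≡k+h+h k h r≡2k+h)) (k+h+h+2≡k+[1+h]+[1+h] k h))

theorem1p5 : (r k n m : ℕ) → 1 ≤ r → 1 ≤ k → 1 ≤ n → 1 ≤ m → k ≤ r →
    TcRKAtMost r k n m (bound r k)
theorem1p5 r k zero m _ _ () _ _
theorem1p5 r k (suc n) zero _ _ _ () _
-- Splitting on the same tests as bound makes the goal reduce to the bound of each case.
theorem1p5 r k (suc n) (suc m) _ 1≤k _ _ k≤r φ with r ≤? 2 * k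
... | yes r≤2k = tc≤r∸k+1 φ zero zero 1≤k k≤r r≤2k
... | no r≰2k with 2 * r ≤? 5 * k
...   | yes 2r≤5k = tc≤2r∸3k+1 φ zero zero 1≤k r≰2k 2r≤5k
...   | no _ = tc≤2r∸3k+2 φ zero zero 1≤k r≰2k
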